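{- Let $r\in\mathbb{N}$, let $f_1,\ldots,f_r:\mathbb{N}\to\mathbb{C}$ be arithmetical functions, let $g$ be a polynomial with integer coefficients, and let $m_1,\ldots,m_r\in\mathbb{N}$ be pairwise relatively prime. Let $M\in\mathbb{N}$ be a multiple of $m_1\cdots m_r$. Then \[ \frac{1}{\phi(M)}\sum_{\substack{k=1\\ \gcd(k,M)=1}}^{M} f_1(\gcd(g(k),m_1))\cdots f_r(\gcd(g(k),m_r))=R_{f_1}^{(g)}(m_1)\cdots R_{f_r}^{(g)}(m_r), \] where for an arithmetical function $f$ and $n\in\mathbb{N}$, \[ R_f^{(g)}(n)=\frac{1}{\phi(n)}\sum_{\substack{k=1\\ \gcd(k,n)=1}}^{n} f(\gcd(g(k),n)). \]
   Context: $\mathbb{N}=\{1,2,\ldots\}$; $\phi$ is Euler's totient function. -}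

module Defs where

open import Level using (Level)
open import Data.Nat as ℕ using (ℕ; zero; suc)
open import Data.Nat.GCD using (gcd)
open import Data.Nat.Properties using (_≟_)
open import Data.Integer as ℤ using (ℤ; ∣_∣)
open import Data.List using (List; []; _∷_; foldr; filter; length; applyUpTo)
open import Data.Fin as Fin using (Fin)
open import Data.Nat.Coprimality using (Coprime)
open import Data.Nat.Divisibility using (_∣_)
open import Relation.Nullary.Decidable using (does)
open import Relation.Binary.PropositionalEquality using (_≡_; _≢_)
open import Algebra.Bundles using (CommutativeRing)

-- Integer polynomial as a coefficient list [a₀, a₁, …, a_d] (constant term first).
IntPoly : Set
IntPoly = List ℤ

evalPoly : IntPoly → ℤ → ℤ
evalPoly []       x = ℤ.+ 0
evalPoly (a ∷ as) x = a ℤ.+ x ℤ.* evalPoly as x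

gcdPoly : IntPoly → ℕ → ℕ → ℕ
gcdPoly g k n = gcd ∣ evalPoly g (ℤ.+ k) ∣ n

oneTo : ℕ → List ℕ
oneTo n = applyUpTo suc n

units : ℕ → List ℕ
units n = filter (λ k → gcd k n ≟ 1) (oneTo n)

φ : ℕ → ℕ
φ n = length (units n)

PairwiseCoprime : {r : ℕ} → (Fin r → ℕ) → Set
PairwiseCoprime {r} m = (i j : Fin r) → i ≢ j → Coprime (m i) (m j)

prodℕ : {r : ℕ} → (Fin r → ℕ) → ℕ
prodℕ {zero}  m = 1
prodℕ {suc r} m = m Fin.zero ℕ.* prodℕ (λ i → m (Fin.suc i))

module RingDefs {c ℓ : Level} (R : CommutativeRing c ℓ) where
  open CommutativeRing R public

  ι : ℕ → Carrier
  ι zero    = 0#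
  ι (suc n) = 1# + ι n

  sumL : List ℕ → (ℕ → Carrier) → Carrier
  sumL xs h = foldr (λ k acc → h k + acc) 0# xs

  prodR : {r : ℕ} → (Fin r → Carrier) → Carrier
  prodR {zero}  a = 1#
  prodR {suc r} a = a Fin.zero * prodR (λ i → a (Fin.suc i))

  -- Unnormalised R_f^{(g)}(n):  Σ_{1≤k≤n, gcd(k,n)=1} f(gcd(g(k),n)),
  -- so that R_f^{(g)}(n) = sumRf g f n / φ(n).
  sumRf : IntPoly → (ℕ → Carrier) → ℕ → Carrier
  sumRf g f n = sumL (units n) (λ k → f (gcdPoly g k n))

module Submission where

-- For n ≥ 1 and a function h : ℕ → R write  T n h = Σ_{0 ≤ k < n, gcd(k,n)=1} h k.
-- If h has period n this is the sum of h over the reduced residues {1,…,n}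
-- (units-sum), and φ n = T n 1.  The proof rests on three facts about T:
--   * Chinese remainder theorem:  for coprime a, b and a-periodic u, b-periodic v,
--     T (a b) (u v) = T a u · T b v, proved by splitting k < ab as k = j a + x and
--     using that j ↦ j a + x permutes the residues mod b;
--   * for d ∣ n and n-periodic h,  T (n d) h = d · T n h;
--   * combining both (strong induction on q):  for every q there is a constant c
--     with T (n q) h = c · T n h for every n-periodic h.
-- The last fact, applied to h and to 1, gives φ(P) · T M h = φ(M) · T P h whenever
-- P ∣ M; no division is needed, so this works in any commutative ring.  With
-- P = m₁⋯m_r and h(k) = Π_i f_i(gcd(g(k), m_i)), which is P-periodic because
-- g(k + n) ≡ g(k) (mod n), the CRT for the family m₁,…,m_r yields the theorem.

open import Defs
open import Level using (Level; _⊔_)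
open import Data.Nat using (ℕ; NonZero)
open import Data.Nat.Divisibility using (_∣_)
open import Data.Fin using (Fin)
open import Algebra.Bundles using (CommutativeRing)

open import Data.Nat as ℕ using (zero; suc; _<_; _≤_)
open import Data.Nat.Properties using (_≟_)
import Data.Nat.Properties as ℕP
open import Data.Nat.Divisibility
  using (divides; ∣-trans; ∣m+n∣m⇒∣n; n∣m*n; m∣m*n; ∣1⇒≡1; ∣⇒≤)
open import Data.Nat.DivMod using (_%_; _/_; m≡m%n+[m/n]*n; m%n<n)
open import Data.Nat.GCD using (gcd; gcd[m,n]∣m; gcd[m,n]∣n; gcd[m,n]≢0; gcd-greatest; gcd-universality)
open import Data.Nat.Coprimality using (Coprime; coprime-divisor; gcd≡1⇒coprime; coprime⇒gcd≡1)
import Data.Nat.Coprimality as Coprimality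
import Data.Nat.Induction as ℕInd
open import Data.Integer as ℤ using (ℤ) renaming (∣_∣ to abs)
import Data.Integer.Properties as ℤP
import Data.Integer.Divisibility.Signed as ℤDiv
open import Data.Integer.Tactic.RingSolver as ℤSolver using ()
open import Data.Nat.Tactic.RingSolver as ℕSolver using ()
open import Data.List using ([]; _∷_; filter; applyUpTo; length)
open import Data.Bool using (Bool; true; false; _∧_)
import Data.Fin as Fin
import Data.Fin.Properties as FinP
open import Data.Fin.Permutation using (Permutation; permutation)
open import Data.Product using (Σ; ∃; _×_; _,_; proj₁; proj₂)
open import Data.Sum using (inj₁; inj₂)
open import Data.Empty using (⊥-elim)
open import Function.Bundles using (_⇔_; mk⇔; module Equivalence)
open import Relation.Nullary using (Dec; yes; no; does; contradiction)
open import Relation.Nullary.Decidable using (_×-dec_; does-⇔)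
open import Relation.Binary.PropositionalEquality as ≡ using (_≡_; _≢_; cong; subst)

module Arithmetic where

  open import Data.Nat using (_+_; _*_)

  gcd-shift : ∀ B Q n → gcd (abs (B ℤ.+ Q ℤ.* ℤ.+ n)) n ≡ gcd (abs B) n
  gcd-shift B Q n = gcd-universality forwards backwards
    where
    A = B ℤ.+ Q ℤ.* ℤ.+ n
    divides-Qn : ∀ {d} → d ∣ n → ℤ.+ d ℤDiv.∣ Q ℤ.* ℤ.+ n
    divides-Qn {d} d∣n = ℤDiv.∣n⇒∣m*n Q (ℤDiv.∣ᵤ⇒∣ {ℤ.+ d} {ℤ.+ n} d∣n)
    forwards : ∀ {d} → d ∣ abs B × d ∣ n → d ∣ gcd (abs A) n
    forwards {d} (d∣B , d∣n) = gcd-greatest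
      (ℤDiv.∣⇒∣ᵤ {ℤ.+ d} {A} (ℤDiv.∣m∣n⇒∣m+n (ℤDiv.∣ᵤ⇒∣ {ℤ.+ d} {B} d∣B) (divides-Qn d∣n))) d∣n
    backwards : ∀ {d} → d ∣ gcd (abs A) n → d ∣ abs B × d ∣ n
    backwards {d} d∣g = ℤDiv.∣⇒∣ᵤ {ℤ.+ d} {B} (ℤDiv.∣m+n∣n⇒∣m (ℤDiv.∣ᵤ⇒∣ {ℤ.+ d} {A} d∣A) (divides-Qn d∣n)) , d∣n
      where
      d∣A = ∣-trans d∣g (gcd[m,n]∣m (abs A) n)
      d∣n = ∣-trans d∣g (gcd[m,n]∣n (abs A) n)

  evalPoly-shift : ∀ g x n → ∃ λ Q → evalPoly g (x ℤ.+ n) ≡ evalPoly g x ℤ.+ Q ℤ.* n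
  evalPoly-shift [] x n = ℤ.+ 0 , ≡.sym (ℤP.+-identityˡ (ℤ.+ 0 ℤ.* n))
  evalPoly-shift (a ∷ as) x n with evalPoly-shift as x n
  ... | Q , eq = x ℤ.* Q ℤ.+ evalPoly as x ℤ.+ Q ℤ.* n ,
    ≡.trans (cong (λ z → a ℤ.+ (x ℤ.+ n) ℤ.* z) eq) (expand a x n (evalPoly as x) Q)
    where
    expand : ∀ a x n E Q → a ℤ.+ (x ℤ.+ n) ℤ.* (E ℤ.+ Q ℤ.* n)
                           ≡ (a ℤ.+ x ℤ.* E) ℤ.+ (x ℤ.* Q ℤ.+ E ℤ.+ Q ℤ.* n) ℤ.* n
    expand = ℤSolver.solve-∀

  gcd-periodic : ∀ k n → gcd (k + n) n ≡ gcd k n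
  gcd-periodic k n = ≡.trans (cong (λ z → gcd (abs (ℤ.+ k ℤ.+ z)) n) (≡.sym (ℤP.*-identityˡ (ℤ.+ n))))
                             (gcd-shift (ℤ.+ k) (ℤ.+ 1) n)

  gcdPoly-periodic : ∀ g k n → gcdPoly g (k + n) n ≡ gcdPoly g k n
  gcdPoly-periodic g k n with evalPoly-shift g (ℤ.+ k) (ℤ.+ n)
  ... | Q , eq = ≡.trans (cong (λ z → gcd (abs z) n) eq) (gcd-shift (evalPoly g (ℤ.+ k)) Q n)

  coprime-*ˡ : ∀ {k a b} → Coprime k (a * b) → Coprime k a
  coprime-*ˡ {b = b} c (d∣k , d∣a) = c (d∣k , ∣-trans d∣a (m∣m*n b))

  coprime-*ʳ : ∀ {k a b} → Coprime k (a * b) → Coprime k b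
  coprime-*ʳ {a = a} c (d∣k , d∣b) = c (d∣k , ∣-trans d∣b (n∣m*n a))

  coprime-* : ∀ {k a b} → Coprime k a → Coprime k b → Coprime k (a * b)
  coprime-* ca cb (d∣k , d∣ab) = cb (d∣k , coprime-divisor (λ (e∣d , e∣a) → ca (∣-trans e∣d d∣k , e∣a)) d∣ab)

  coprime-∣ : ∀ {k a d} → d ∣ a → Coprime k a → Coprime k d
  coprime-∣ d∣a c (x∣k , x∣d) = c (x∣k , ∣-trans x∣d d∣a)

  %-cancel : ∀ u w b .{{_ : NonZero b}} → (u + w) % b ≡ u % b → b ∣ w
  %-cancel u w b eq = ∣m+n∣m⇒∣n (subst (b ∣_) (≡.sym shifted) (n∣m*n X)) (n∣m*n Y)
    where
    X = (u + w) / b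
    Y = u / b
    shifted : Y * b + w ≡ X * b
    shifted = ℕP.+-cancelˡ-≡ (u % b) _ _ (begin
      u % b + (Y * b + w)  ≡⟨ ≡.sym (ℕP.+-assoc (u % b) (Y * b) w) ⟩
      (u % b + Y * b) + w  ≡⟨ cong (_+ w) (≡.sym (m≡m%n+[m/n]*n u b)) ⟩
      u + w                ≡⟨ m≡m%n+[m/n]*n (u + w) b ⟩
      (u + w) % b + X * b  ≡⟨ cong (_+ X * b) eq ⟩
      u % b + X * b        ∎)
      where open ≡.≡-Reasoning

  <-∣⇒≡0 : ∀ {b t} → t < b → b ∣ t → t ≡ 0
  <-∣⇒≡0 {t = zero}  _   _   = ≡.refl
  <-∣⇒≡0 {t = suc t} t<b b∣t = contradiction (∣⇒≤ b∣t) (ℕP.<⇒≱ t<b)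

  affine-mod-injective-≤ : ∀ b a x .{{_ : NonZero b}} → Coprime b a → ∀ {i j} → i ≤ j → j < b →
                           (i * a + x) % b ≡ (j * a + x) % b → i ≡ j
  affine-mod-injective-≤ b a x cop {i} i≤j j<b eq with ℕP.m≤n⇒∃[o]m+o≡n i≤j
  ... | t , ≡.refl = ≡.sym (≡.trans (cong (i +_) t≡0) (ℕP.+-identityʳ i))
    where
    expand : ∀ i t a x → (i + t) * a + x ≡ (i * a + x) + t * a
    expand = ℕSolver.solve-∀
    b∣ta : b ∣ t * a
    b∣ta = %-cancel (i * a + x) (t * a) b (≡.trans (cong (_% b) (≡.sym (expand i t a x))) (≡.sym eq))
    t≡0 : t ≡ 0
    t≡0 = <-∣⇒≡0 (ℕP.≤-<-trans (ℕP.m≤m+n t i) (subst (_< b) (ℕP.+-comm i t) j<b))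
                 (coprime-divisor cop (subst (b ∣_) (ℕP.*-comm t a) b∣ta))

  affine-mod-injective : ∀ b a x .{{_ : NonZero b}} → Coprime b a → ∀ {i j} → i < b → j < b →
                         (i * a + x) % b ≡ (j * a + x) % b → i ≡ j
  affine-mod-injective b a x cop {i} {j} i<b j<b eq with ℕP.≤-total i j
  ... | inj₁ i≤j = affine-mod-injective-≤ b a x cop i≤j j<b eq
  ... | inj₂ j≤i = ≡.sym (affine-mod-injective-≤ b a x cop j≤i i<b (≡.sym eq))

  injective⇒surjective : ∀ {n} (f : Fin n → Fin n) → (∀ {x y} → f x ≡ f y → x ≡ y) →
                         ∀ y → ∃ λ x → f x ≡ y
  injective⇒surjective {suc n} f inj y with FinP.any? (λ x → f x FinP.≟ y)
  ... | yes hit = hit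
  ... | no miss = ⊥-elim (ℕP.1+n≰n (FinP.injective⇒≤ {f = squeeze} squeeze-injective))
    where
    avoids : ∀ x → y ≢ f x
    avoids x eq = miss (x , ≡.sym eq)
    squeeze : Fin (suc n) → Fin n
    squeeze x = Fin.punchOut (avoids x)
    squeeze-injective : ∀ {x x'} → squeeze x ≡ squeeze x' → x ≡ x'
    squeeze-injective {x} {x'} eq = inj (FinP.punchOut-injective (avoids x) (avoids x') eq)

  prodℕ-nonZero : ∀ {r} (m : Fin r → ℕ) → (∀ i → NonZero (m i)) → NonZero (prodℕ m)
  prodℕ-nonZero {zero}  m nz = _
  prodℕ-nonZero {suc r} m nz =
    ℕP.m*n≢0 (m Fin.zero) (prodℕ (λ i → m (Fin.suc i))) {{nz Fin.zero}} {{prodℕ-nonZero _ (λ i → nz (Fin.suc i))}}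

  coprime-prodℕ : ∀ k {r} (m : Fin r → ℕ) → (∀ i → Coprime k (m i)) → Coprime k (prodℕ m)
  coprime-prodℕ k {zero}  m cop (_ , d∣1) = ∣1⇒≡1 d∣1
  coprime-prodℕ k {suc r} m cop = coprime-* (cop Fin.zero) (coprime-prodℕ k _ (λ i → cop (Fin.suc i)))

open Arithmetic

module ReducedSums {c ℓ : Level} (R : CommutativeRing c ℓ) where

  open import Data.Nat using (_+_; _*_)

  open RingDefs R using (ι; sumL; prodR; sumRf)
  open CommutativeRing R renaming (_+_ to _⊕_; _*_ to _⊗_)
  open import Algebra.Properties.Semiring.Sum semiring using (sum; sum-cong-≗; ∑-comm; *-distribˡ-sum; sum-permute)
  open import Algebra.Properties.Group +-group using (∙-cancelˡ)
  open import Algebra.Properties.CommutativeSemigroup *-commutativeSemigroup using (interchange; x∙yz≈yx∙z)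
  open import Relation.Binary.Reasoning.Setoid setoid

  [_] : Bool → Carrier
  [ true ]  = 1#
  [ false ] = 0#

  [∧] : ∀ x y → [ x ∧ y ] ≈ [ x ] ⊗ [ y ]
  [∧] true  y = sym (*-identityˡ [ y ])
  [∧] false y = sym (zeroˡ [ y ])

  S : ℕ → (ℕ → Carrier) → Carrier
  S zero    F = 0#
  S (suc n) F = F 0 ⊕ S n (λ k → F (suc k))

  S-as-sum : ∀ n (F : ℕ → Carrier) → S n F ≡ sum {n} (λ i → F (Fin.toℕ i))
  S-as-sum zero    F = ≡.refl
  S-as-sum (suc n) F = cong (F 0 ⊕_) (S-as-sum n (λ k → F (suc k)))

  S-cong : ∀ n {F G : ℕ → Carrier} → (∀ k → F k ≈ G k) → S n F ≈ S n G
  S-cong zero    eq = refl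
  S-cong (suc n) eq = +-cong (eq 0) (S-cong n (λ k → eq (suc k)))

  S-*ˡ : ∀ n a (F : ℕ → Carrier) → S n (λ k → a ⊗ F k) ≈ a ⊗ S n F
  S-*ˡ n a F = begin
    S n (λ k → a ⊗ F k)                ≡⟨ S-as-sum n (λ k → a ⊗ F k) ⟩
    sum {n} (λ i → a ⊗ F (Fin.toℕ i))  ≈⟨ sym (*-distribˡ-sum {n} a (λ i → F (Fin.toℕ i))) ⟩
    a ⊗ sum {n} (λ i → F (Fin.toℕ i))  ≡⟨ cong (a ⊗_) (≡.sym (S-as-sum n F)) ⟩
    a ⊗ S n F                          ∎

  S-*ʳ : ∀ n a (F : ℕ → Carrier) → S n (λ k → F k ⊗ a) ≈ S n F ⊗ a
  S-*ʳ n a F = trans (S-cong n (λ k → *-comm (F k) a)) (trans (S-*ˡ n a F) (*-comm a _))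

  S-const : ∀ n a → S n (λ _ → a) ≈ ι n ⊗ a
  S-const zero    a = sym (zeroˡ a)
  S-const (suc n) a = trans (+-cong (sym (*-identityˡ a)) (S-const n a)) (sym (distribʳ a 1# (ι n)))

  S-swap : ∀ m n (F : ℕ → ℕ → Carrier) → S m (λ i → S n (F i)) ≈ S n (λ j → S m (λ i → F i j))
  S-swap m n F = begin
    S m (λ i → S n (F i))
      ≡⟨ S-as-sum m _ ⟩
    sum {m} (λ i → S n (F (Fin.toℕ i)))
      ≡⟨ sum-cong-≗ {m} (λ i → S-as-sum n (F (Fin.toℕ i))) ⟩
    sum {m} (λ i → sum {n} (λ j → F (Fin.toℕ i) (Fin.toℕ j)))
      ≈⟨ ∑-comm {m} {n} (λ i j → F (Fin.toℕ i) (Fin.toℕ j)) ⟩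
    sum {n} (λ j → sum {m} (λ i → F (Fin.toℕ i) (Fin.toℕ j)))
      ≡⟨ sum-cong-≗ {n} (λ j → ≡.sym (S-as-sum m (λ i → F i (Fin.toℕ j)))) ⟩
    sum {n} (λ j → S m (λ i → F i (Fin.toℕ j)))
      ≡⟨ ≡.sym (S-as-sum n _) ⟩
    S n (λ j → S m (λ i → F i j))
      ∎

  S-split : ∀ m n (F : ℕ → Carrier) → S (m + n) F ≈ S m F ⊕ S n (λ k → F (m + k))
  S-split zero    n F = sym (+-identityˡ _)
  S-split (suc m) n F = trans (+-congˡ (S-split m n (λ k → F (suc k)))) (sym (+-assoc _ _ _))

  S-blocks : ∀ q a (F : ℕ → Carrier) → S (q * a) F ≈ S q (λ j → S a (λ x → F (j * a + x)))
  S-blocks zero    a F = refl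
  S-blocks (suc q) a F = trans (S-split a (q * a) F) (+-congˡ (trans (S-blocks q a (λ k → F (a + k)))
    (S-cong q (λ j → S-cong a (λ x → reflexive (cong F (≡.sym (ℕP.+-assoc a (j * a) x))))))))

  S-rotate : ∀ n (F : ℕ → Carrier) → F n ≈ F 0 → S n (λ k → F (suc k)) ≈ S n F
  S-rotate n F Fn≈F0 = ∙-cancelˡ (F 0) _ _ (trans (snoc n F) (trans (+-congˡ Fn≈F0) (+-comm _ _)))
    where
    snoc : ∀ n (F : ℕ → Carrier) → S (suc n) F ≈ S n F ⊕ F n
    snoc zero    F = +-comm _ _
    snoc (suc n) F = trans (+-congˡ (snoc n (λ k → F (suc k)))) (sym (+-assoc _ _ _))

  S-reindex : ∀ n (σ : ℕ → ℕ) → (∀ j → j < n → σ j < n) → (∀ {i j} → i < n → j < n → σ i ≡ σ j → i ≡ j) →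
              (F : ℕ → Carrier) → S n (λ j → F (σ j)) ≈ S n F
  S-reindex n σ σ< σ-inj F = begin
    S n (λ j → F (σ j))                 ≡⟨ S-as-sum n (λ j → F (σ j)) ⟩
    sum {n} (λ i → F (σ (Fin.toℕ i)))  ≡⟨ sum-cong-≗ {n} (λ i → cong F (≡.sym (σ̂-toℕ i))) ⟩
    sum {n} (λ i → F (Fin.toℕ (σ̂ i)))  ≈⟨ sym (sum-permute (λ i → F (Fin.toℕ i)) π) ⟩
    sum {n} (λ i → F (Fin.toℕ i))      ≡⟨ ≡.sym (S-as-sum n F) ⟩
    S n F                               ∎
    where
    σ̂ : Fin n → Fin n
    σ̂ i = Fin.fromℕ< (σ< (Fin.toℕ i) (FinP.toℕ<n i))
    σ̂-toℕ : ∀ i → Fin.toℕ (σ̂ i) ≡ σ (Fin.toℕ i)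
    σ̂-toℕ i = FinP.toℕ-fromℕ< (σ< (Fin.toℕ i) (FinP.toℕ<n i))
    σ̂-injective : ∀ {i j} → σ̂ i ≡ σ̂ j → i ≡ j
    σ̂-injective {i} {j} eq = FinP.toℕ-injective (σ-inj (FinP.toℕ<n i) (FinP.toℕ<n j)
      (≡.trans (≡.sym (σ̂-toℕ i)) (≡.trans (cong Fin.toℕ eq) (σ̂-toℕ j))))
    σ̂⁻¹ : Fin n → Fin n
    σ̂⁻¹ y = proj₁ (injective⇒surjective σ̂ σ̂-injective y)
    π : Permutation n n
    π = permutation σ̂ σ̂⁻¹ (λ y → proj₂ (injective⇒surjective σ̂ σ̂-injective y))
                          (λ x → σ̂-injective (proj₂ (injective⇒surjective σ̂ σ̂-injective (σ̂ x))))

  Periodic : ℕ → (ℕ → Carrier) → Set ℓ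
  Periodic n F = ∀ k → F (k + n) ≈ F k

  periodic-multiple : ∀ n (F : ℕ → Carrier) → Periodic n F → ∀ j k → F (k + j * n) ≈ F k
  periodic-multiple n F p zero    k = reflexive (cong F (ℕP.+-identityʳ k))
  periodic-multiple n F p (suc j) k = begin
    F (k + (n + j * n))  ≡⟨ cong F (ℕP.+-comm k (n + j * n)) ⟩
    F ((n + j * n) + k)  ≡⟨ cong F (ℕP.+-assoc n (j * n) k) ⟩
    F (n + (j * n + k))  ≡⟨ cong F (ℕP.+-comm n (j * n + k)) ⟩
    F ((j * n + k) + n)  ≈⟨ p (j * n + k) ⟩
    F (j * n + k)        ≡⟨ cong F (ℕP.+-comm (j * n) k) ⟩
    F (k + j * n)        ≈⟨ periodic-multiple n F p j k ⟩
    F k                  ∎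

  periodic-block : ∀ n (F : ℕ → Carrier) → Periodic n F → ∀ j x → F (j * n + x) ≈ F x
  periodic-block n F p j x = trans (reflexive (cong F (ℕP.+-comm (j * n) x))) (periodic-multiple n F p j x)

  periodic-scale : ∀ n d (F : ℕ → Carrier) → Periodic n F → Periodic (n * d) F
  periodic-scale n d F p k = trans (reflexive (cong (λ z → F (k + z)) (ℕP.*-comm n d))) (periodic-multiple n F p d k)

  periodic-mod : ∀ n .{{_ : NonZero n}} (F : ℕ → Carrier) → Periodic n F → ∀ k → F k ≈ F (k % n)
  periodic-mod n F p k = trans (reflexive (cong F (m≡m%n+[m/n]*n k n))) (periodic-multiple n F p (k / n) (k % n))

  periodic-* : ∀ a b (u v : ℕ → Carrier) → Periodic a u → Periodic b v → Periodic (a * b) (λ k → u k ⊗ v k)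
  periodic-* a b u v pu pv k = *-cong (periodic-scale a b u pu k)
    (trans (reflexive (cong (λ z → v (k + z)) (ℕP.*-comm a b))) (periodic-scale b a v pv k))

  e : ℕ → ℕ → Carrier
  e n k = [ does (gcd k n ≟ 1) ]

  e-cong : ∀ a b k → (Coprime k a ⇔ Coprime k b) → e a k ≈ e b k
  e-cong a b k a⇔b = reflexive (cong [_] (does-⇔ gcd≡1-⇔ (gcd k a ≟ 1) (gcd k b ≟ 1)))
    where
    gcd≡1-⇔ : gcd k a ≡ 1 ⇔ gcd k b ≡ 1
    gcd≡1-⇔ = mk⇔ (λ p → coprime⇒gcd≡1 (Equivalence.to a⇔b (gcd≡1⇒coprime p)))
                  (λ p → coprime⇒gcd≡1 (Equivalence.from a⇔b (gcd≡1⇒coprime p)))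

  e-* : ∀ a b k → e (a * b) k ≈ e a k ⊗ e b k
  e-* a b k = trans (reflexive (cong [_] (does-⇔ gcd≡1-⇔ (gcd k (a * b) ≟ 1) ((gcd k a ≟ 1) ×-dec (gcd k b ≟ 1)))))
                    ([∧] (does (gcd k a ≟ 1)) (does (gcd k b ≟ 1)))
    where
    gcd≡1-⇔ : gcd k (a * b) ≡ 1 ⇔ (gcd k a ≡ 1 × gcd k b ≡ 1)
    gcd≡1-⇔ = mk⇔
      (λ p → coprime⇒gcd≡1 (coprime-*ˡ {k} {a} {b} (gcd≡1⇒coprime p))
           , coprime⇒gcd≡1 (coprime-*ʳ {k} {a} {b} (gcd≡1⇒coprime p)))
      (λ (p , q) → coprime⇒gcd≡1 (coprime-* {k} {a} {b} (gcd≡1⇒coprime p) (gcd≡1⇒coprime q)))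

  e-periodic : ∀ n → Periodic n (e n)
  e-periodic n k = reflexive (cong (λ z → [ does (z ≟ 1) ]) (gcd-periodic k n))

  T : ℕ → (ℕ → Carrier) → Carrier
  T n h = S n (λ k → e n k ⊗ h k)

  reduced-periodic : ∀ n (h : ℕ → Carrier) → Periodic n h → Periodic n (λ k → e n k ⊗ h k)
  reduced-periodic n h ph k = *-cong (e-periodic n k) (ph k)

  sumL-filter : ∀ {p} {Q : ℕ → Set p} (Q? : (x : ℕ) → Dec (Q x)) xs (h : ℕ → Carrier) →
                sumL (filter Q? xs) h ≈ sumL xs (λ k → [ does (Q? k) ] ⊗ h k)
  sumL-filter Q? []       h = refl
  sumL-filter Q? (x ∷ xs) h with does (Q? x)
  ... | true  = +-cong (sym (*-identityˡ _)) (sumL-filter Q? xs h)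
  ... | false = trans (sumL-filter Q? xs h) (sym (trans (+-congʳ (zeroˡ _)) (+-identityˡ _)))

  sumL-applyUpTo : ∀ n (f : ℕ → ℕ) (H : ℕ → Carrier) → sumL (applyUpTo f n) H ≈ S n (λ k → H (f k))
  sumL-applyUpTo zero    f H = refl
  sumL-applyUpTo (suc n) f H = +-congˡ (sumL-applyUpTo n (λ k → f (suc k)) H)

  -- For n-periodic h the sum over the units {1,…,n} is T n h (shift the range by one).
  units-sum : ∀ n (h : ℕ → Carrier) → Periodic n h → sumL (units n) h ≈ T n h
  units-sum n h ph = begin
    sumL (units n) h                          ≈⟨ sumL-filter (λ k → gcd k n ≟ 1) (oneTo n) h ⟩
    sumL (oneTo n) (λ k → e n k ⊗ h k)         ≈⟨ sumL-applyUpTo n suc (λ k → e n k ⊗ h k) ⟩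
    S n (λ k → e n (suc k) ⊗ h (suc k))       ≈⟨ S-rotate n (λ k → e n k ⊗ h k) (reduced-periodic n h ph 0) ⟩
    T n h                                     ∎

  sumL-1 : ∀ xs → sumL xs (λ _ → 1#) ≈ ι (length xs)
  sumL-1 []       = refl
  sumL-1 (x ∷ xs) = +-congˡ (sumL-1 xs)

  φ-as-T : ∀ n → ι (φ n) ≈ T n (λ _ → 1#)
  φ-as-T n = trans (sym (sumL-1 (units n))) (units-sum n (λ _ → 1#) (λ _ → refl))

  S-repeat : ∀ d n (G : ℕ → Carrier) → Periodic n G → S (d * n) G ≈ ι d ⊗ S n G
  S-repeat d n G pG = begin
    S (d * n) G                             ≈⟨ S-blocks d n G ⟩
    S d (λ j → S n (λ x → G (j * n + x)))   ≈⟨ S-cong d (λ j → S-cong n (periodic-block n G pG j)) ⟩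
    S d (λ _ → S n G)                       ≈⟨ S-const d (S n G) ⟩
    ι d ⊗ S n G                             ∎

  -- For a coprime to b, j ↦ j a + x permutes the residues mod b.
  S-affine : ∀ b a x .{{_ : NonZero b}} → Coprime b a → (V : ℕ → Carrier) → Periodic b V →
             S b (λ j → V (j * a + x)) ≈ S b V
  S-affine b a x cop V pV = trans (S-cong b (λ j → periodic-mod b V pV (j * a + x)))
    (S-reindex b (λ j → (j * a + x) % b) (λ j _ → m%n<n (j * a + x) b)
               (affine-mod-injective b a x cop) V)

  -- If d ∣ n then gcd(k, n d) = 1 iff gcd(k, n) = 1, so T (n d) h counts each class d times.
  T-divisor : ∀ n d → d ∣ n → (h : ℕ → Carrier) → Periodic n h → T (n * d) h ≈ ι d ⊗ T n h
  T-divisor n d d∣n h ph = begin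
    T (n * d) h   ≈⟨ S-cong (n * d) (λ k → *-congʳ (e-cong (n * d) n k same-units)) ⟩
    S (n * d) G   ≡⟨ cong (λ z → S z G) (ℕP.*-comm n d) ⟩
    S (d * n) G   ≈⟨ S-repeat d n G (reduced-periodic n h ph) ⟩
    ι d ⊗ T n h   ∎
    where
    G : ℕ → Carrier
    G k = e n k ⊗ h k
    same-units : ∀ {k} → Coprime k (n * d) ⇔ Coprime k n
    same-units {k} = mk⇔ (coprime-*ˡ {k} {n} {d})
                         (λ c → coprime-* {k} {n} {d} c (coprime-∣ {k} {n} {d} d∣n c))

  T-CRT : ∀ a b .{{_ : NonZero b}} → Coprime a b → (u v : ℕ → Carrier) → Periodic a u → Periodic b v →
          T (a * b) (λ k → u k ⊗ v k) ≈ T a u ⊗ T b v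
  T-CRT a b cop u v pu pv = begin
    T (a * b) (λ k → u k ⊗ v k)                    ≈⟨ S-cong (a * b) (λ k → split-weight k) ⟩
    S (a * b) (λ k → U k ⊗ V k)                    ≡⟨ cong (λ z → S z (λ k → U k ⊗ V k)) (ℕP.*-comm a b) ⟩
    S (b * a) (λ k → U k ⊗ V k)                    ≈⟨ S-blocks b a (λ k → U k ⊗ V k) ⟩
    S b (λ j → S a (λ x → U (j * a + x) ⊗ V (j * a + x)))
                         ≈⟨ S-cong b (λ j → S-cong a (λ x → *-congʳ (periodic-block a U (reduced-periodic a u pu) j x))) ⟩
    S b (λ j → S a (λ x → U x ⊗ V (j * a + x)))    ≈⟨ S-swap b a (λ j x → U x ⊗ V (j * a + x)) ⟩
    S a (λ x → S b (λ j → U x ⊗ V (j * a + x)))    ≈⟨ S-cong a (λ x → S-*ˡ b (U x) (λ j → V (j * a + x))) ⟩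
    S a (λ x → U x ⊗ S b (λ j → V (j * a + x)))    ≈⟨ S-cong a (λ x → *-congˡ (S-affine b a x (Coprimality.sym cop) V pV)) ⟩
    S a (λ x → U x ⊗ S b V)                        ≈⟨ S-*ʳ a (S b V) U ⟩
    T a u ⊗ T b v                                  ∎
    where
    U V : ℕ → Carrier
    U k = e a k ⊗ u k
    V k = e b k ⊗ v k
    pV : Periodic b V
    pV = reduced-periodic b v pv
    split-weight : ∀ k → e (a * b) k ⊗ (u k ⊗ v k) ≈ U k ⊗ V k
    split-weight k = trans (*-congʳ (e-* a b k)) (interchange (e a k) (e b k) (u k) (v k))

  -- Passing from modulus n to a multiple n q rescales T on n-periodic functions by a
  -- constant depending only on n and q.  (Over a general ring we cannot divide by φ,
  -- so the constant is produced explicitly.)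
  ScalesToMultiple : ℕ → ℕ → Set (c ⊔ ℓ)
  ScalesToMultiple n q = Σ Carrier λ κ → (h : ℕ → Carrier) → Periodic n h → T (n * q) h ≈ κ ⊗ T n h

  -- Strong induction on q: if gcd(n, q) = 1 use the CRT; otherwise with d = gcd(n, q) > 1
  -- and q = q' d, pass first to n d (T-divisor) and then to (n d) q' = n q (induction).
  T-multiple : ∀ q n → NonZero n → NonZero q → ScalesToMultiple n q
  T-multiple = ℕInd.<-rec (λ q → ∀ n → NonZero n → NonZero q → ScalesToMultiple n q) step
    where
    step : ∀ q → (∀ {q'} → q' < q → ∀ n → NonZero n → NonZero q' → ScalesToMultiple n q') →
           ∀ n → NonZero n → NonZero q → ScalesToMultiple n q
    step q IH n nz-n nz-q with gcd n q ≟ 1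
    ... | yes gcd≡1 = T q (λ _ → 1#) , λ h ph → begin
        T (n * q) h                     ≈⟨ S-cong (n * q) (λ k → *-congˡ (sym (*-identityʳ (h k)))) ⟩
        T (n * q) (λ k → h k ⊗ 1#)      ≈⟨ T-CRT n q {{nz-q}} (gcd≡1⇒coprime gcd≡1) h (λ _ → 1#) ph (λ _ → refl) ⟩
        T n h ⊗ T q (λ _ → 1#)          ≈⟨ *-comm _ _ ⟩
        T q (λ _ → 1#) ⊗ T n h          ∎
    ... | no gcd≢1 with gcd[m,n]∣n n q
    ...   | divides q' q≡q'd = κ ⊗ ι d , λ h ph → begin
        T (n * q) h              ≡⟨ cong (λ z → T z h) nq≡ndq' ⟩
        T ((n * d) * q') h       ≈⟨ scale h (periodic-scale n d h ph) ⟩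
        κ ⊗ T (n * d) h          ≈⟨ *-congˡ (T-divisor n d (gcd[m,n]∣m n q) h ph) ⟩
        κ ⊗ (ι d ⊗ T n h)        ≈⟨ sym (*-assoc _ _ _) ⟩
        (κ ⊗ ι d) ⊗ T n h        ∎
      where
      d = gcd n q
      nz-d : NonZero d
      nz-d = ℕ.≢-nonZero (gcd[m,n]≢0 n q (inj₁ (ℕ.≢-nonZero⁻¹ n {{nz-n}})))
      nz-q' : NonZero q'
      nz-q' = ℕ.≢-nonZero (λ q'≡0 → ℕ.≢-nonZero⁻¹ q {{nz-q}} (≡.trans q≡q'd (cong (_* d) q'≡0)))
      1<d : 1 < d
      1<d = ℕP.≤∧≢⇒< (ℕ.>-nonZero⁻¹ d {{nz-d}}) (≡.≢-sym gcd≢1)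
      q'<q : q' < q
      q'<q = subst (q' <_) (≡.sym q≡q'd) (ℕP.m<m*n q' d {{nz-q'}} 1<d)
      nq≡ndq' : n * q ≡ (n * d) * q'
      nq≡ndq' = ≡.trans (cong (n *_) (≡.trans q≡q'd (ℕP.*-comm q' d))) (≡.sym (ℕP.*-assoc n d q'))
      rec = IH q'<q (n * d) (ℕP.m*n≢0 n d {{nz-n}} {{nz-d}}) nz-q'
      κ = proj₁ rec
      scale = proj₂ rec

  periodic-∣ : ∀ {P M} (F : ℕ → Carrier) → P ∣ M → Periodic P F → Periodic M F
  periodic-∣ {P} F (divides q M≡qP) pF k =
    trans (reflexive (cong (λ z → F (k + z)) (≡.trans M≡qP (ℕP.*-comm q P)))) (periodic-scale P q F pF k)

  -- The paper's averaging identity, cleared of denominators: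
  -- for P ∣ M and P-periodic h,  φ(P) · T M h = φ(M) · T P h.
  T-ratio : ∀ P M → NonZero P → NonZero M → P ∣ M → (h : ℕ → Carrier) → Periodic P h →
            ι (φ P) ⊗ T M h ≈ ι (φ M) ⊗ T P h
  T-ratio P M nz-P nz-M (divides q M≡qP) h ph = begin
    ι (φ P) ⊗ T M h           ≈⟨ *-congˡ (scale-M h ph) ⟩
    ι (φ P) ⊗ (κ ⊗ T P h)     ≈⟨ x∙yz≈yx∙z (ι (φ P)) κ (T P h) ⟩
    (κ ⊗ ι (φ P)) ⊗ T P h     ≈⟨ *-congʳ (sym φM≈κφP) ⟩
    ι (φ M) ⊗ T P h           ∎
    where
    M≡Pq : M ≡ P * q
    M≡Pq = ≡.trans M≡qP (ℕP.*-comm q P)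
    nz-q : NonZero q
    nz-q = ℕ.≢-nonZero (λ q≡0 → ℕ.≢-nonZero⁻¹ M {{nz-M}} (≡.trans M≡qP (cong (_* P) q≡0)))
    rec = T-multiple q P nz-P nz-q
    κ = proj₁ rec
    scale-M : ∀ h → Periodic P h → T M h ≈ κ ⊗ T P h
    scale-M h ph = trans (reflexive (cong (λ z → T z h) M≡Pq)) (proj₂ rec h ph)
    φM≈κφP : ι (φ M) ≈ κ ⊗ ι (φ P)
    φM≈κφP = trans (φ-as-T M) (trans (scale-M (λ _ → 1#) (λ _ → refl)) (*-congˡ (sym (φ-as-T P))))

  prodR-cong : ∀ {r} {a b : Fin r → Carrier} → (∀ i → a i ≈ b i) → prodR a ≈ prodR b
  prodR-cong {zero}  eq = refl
  prodR-cong {suc r} eq = *-cong (eq Fin.zero) (prodR-cong (λ i → eq (Fin.suc i)))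

  prodR-1 : ∀ r → prodR {r} (λ _ → 1#) ≈ 1#
  prodR-1 zero    = refl
  prodR-1 (suc r) = trans (*-congˡ (prodR-1 r)) (*-identityʳ 1#)

  prodR-periodic : ∀ {r} (m : Fin r → ℕ) (F : Fin r → ℕ → Carrier) → (∀ i → Periodic (m i) (F i)) →
                   Periodic (prodℕ m) (λ k → prodR (λ i → F i k))
  prodR-periodic {zero}  m F p k = refl
  prodR-periodic {suc r} m F p = periodic-* (m Fin.zero) (prodℕ (λ i → m (Fin.suc i))) (F Fin.zero) _ (p Fin.zero)
    (prodR-periodic (λ i → m (Fin.suc i)) (λ i → F (Fin.suc i)) (λ i → p (Fin.suc i)))

  T-prodR : ∀ {r} (m : Fin r → ℕ) → (∀ i → NonZero (m i)) → PairwiseCoprime m →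
            (F : Fin r → ℕ → Carrier) → (∀ i → Periodic (m i) (F i)) →
            T (prodℕ m) (λ k → prodR (λ i → F i k)) ≈ prodR (λ i → T (m i) (F i))
  T-prodR {zero}  m nz pc F p = trans (+-identityʳ _) (*-identityˡ 1#)
  T-prodR {suc r} m nz pc F p = trans
    (T-CRT (m Fin.zero) (prodℕ m') {{prodℕ-nonZero m' (λ i → nz (Fin.suc i))}}
       (coprime-prodℕ (m Fin.zero) m' (λ i → pc Fin.zero (Fin.suc i) (λ ())))
       (F Fin.zero) _ (p Fin.zero) (prodR-periodic m' (λ i → F (Fin.suc i)) (λ i → p (Fin.suc i))))
    (*-congˡ (T-prodR m' (λ i → nz (Fin.suc i)) tail-coprime (λ i → F (Fin.suc i)) (λ i → p (Fin.suc i))))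
    where
    m' : Fin r → ℕ
    m' i = m (Fin.suc i)
    tail-coprime : PairwiseCoprime m'
    tail-coprime i j i≢j = pc (Fin.suc i) (Fin.suc j) (λ eq → i≢j (FinP.suc-injective eq))

  φ-prodR : ∀ {r} (m : Fin r → ℕ) → (∀ i → NonZero (m i)) → PairwiseCoprime m →
            ι (φ (prodℕ m)) ≈ prodR (λ i → ι (φ (m i)))
  φ-prodR {r} m nz pc = begin
    ι (φ (prodℕ m))                              ≈⟨ φ-as-T (prodℕ m) ⟩
    T (prodℕ m) (λ _ → 1#)                       ≈⟨ S-cong (prodℕ m) (λ k → *-congˡ (sym (prodR-1 r))) ⟩
    T (prodℕ m) (λ _ → prodR {r} (λ _ → 1#))     ≈⟨ T-prodR m nz pc (λ _ _ → 1#) (λ _ _ → refl) ⟩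
    prodR (λ i → T (m i) (λ _ → 1#))             ≈⟨ prodR-cong (λ i → sym (φ-as-T (m i))) ⟩
    prodR (λ i → ι (φ (m i)))                    ∎

corollary3 : {c ℓ : Level} (R : CommutativeRing c ℓ) → let open RingDefs R in
  (r : ℕ) (f : Fin r → ℕ → Carrier) (g : IntPoly) (m : Fin r → ℕ) →
  ((i : Fin r) → NonZero (m i)) → PairwiseCoprime m →
  (M : ℕ) → NonZero M → prodℕ m ∣ M →
  prodR (λ i → ι (φ (m i))) * sumL (units M) (λ k → prodR (λ i → f i (gcdPoly g k (m i))))
    ≈ ι (φ M) * prodR (λ i → sumRf g (f i) (m i))
corollary3 R r f g m nz pc M nz-M P∣M = begin
  prodR (λ i → ι (φ (m i))) ⊗ sumL (units M) F  ≈⟨ *-cong (sym (φ-prodR m nz pc)) (units-sum M F F-periodic-M) ⟩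
  ι (φ P) ⊗ T M F                              ≈⟨ T-ratio P M (prodℕ-nonZero m nz) nz-M P∣M F F-periodic ⟩
  ι (φ M) ⊗ T P F                              ≈⟨ *-congˡ (T-prodR m nz pc Fᵢ Fᵢ-periodic) ⟩
  ι (φ M) ⊗ prodR (λ i → T (m i) (Fᵢ i))        ≈⟨ *-congˡ (prodR-cong (λ i → sym (units-sum (m i) (Fᵢ i) (Fᵢ-periodic i)))) ⟩
  ι (φ M) ⊗ prodR (λ i → sumRf g (f i) (m i))  ∎
  where
  open ReducedSums R
  open RingDefs R using (ι; sumL; prodR; sumRf; Carrier; setoid; sym; reflexive; *-cong; *-congˡ)
    renaming (_*_ to _⊗_)
  open import Relation.Binary.Reasoning.Setoid setoid
  P = prodℕ m
  Fᵢ : Fin r → ℕ → Carrier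
  Fᵢ i k = f i (gcdPoly g k (m i))
  F : ℕ → Carrier
  F k = prodR (λ i → Fᵢ i k)
  Fᵢ-periodic : ∀ i → Periodic (m i) (Fᵢ i)
  Fᵢ-periodic i k = reflexive (cong (f i) (gcdPoly-periodic g k (m i)))
  F-periodic : Periodic P F
  F-periodic = prodR-periodic m Fᵢ Fᵢ-periodic
  F-periodic-M : Periodic M F
  F-periodic-M = periodic-∣ F P∣M F-periodic
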